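{- (1) co-PFP is equivalent to LPO. (2) co-WPFP is equivalent to WPFP.
   Context: Work in Bishop-style constructive mathematics: intuitionistic logic with countable and dependent choice; "equivalent" means mutual implication over this base. LPO: for every binary sequence $(a_n)$, either $\forall n\,(a_n=0)$ or $\exists n\,(a_n=1)$. co-PFP: for every binary sequence $(a_n)$ there exists a binary sequence $(b_n)$ with $\exists n\,(a_n=1)\iff\forall n\,(b_n=0)$. WPFP: for every binary sequence $(a_n)$ there exists a binary sequence $(b_n)$ with $\forall n\,(a_n=0)\iff\neg\forall n\,(b_n=0)$. co-WPFP: for every binary sequence $(a_n)$ there exists a binary sequence $(b_n)$ with $\neg\forall n\,(a_n=0)\iff\forall n\,(b_n=0)$. -}

module Defs where

open import Data.Bool using (Bool; true; false)
open import Data.Nat using (ℕ)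
open import Data.Product using (Σ; _×_)
open import Data.Sum using (_⊎_)
open import Relation.Nullary using (¬_)
open import Relation.Binary.PropositionalEquality using (_≡_)

-- binary sequences; "a_n = 0" is  a n ≡ false, "a_n = 1" is  a n ≡ true
BinSeq : Set
BinSeq = ℕ → Bool

AllZero : BinSeq → Set
AllZero a = ∀ n → a n ≡ false

SomeOne : BinSeq → Set
SomeOne a = Σ ℕ (λ n → a n ≡ true)

_↔_ : Set → Set → Set
P ↔ Q = (P → Q) × (Q → P)

infix 1 _↔_

LPO : Set
LPO = ∀ (a : BinSeq) → AllZero a ⊎ SomeOne a

co-PFP : Set
co-PFP = ∀ (a : BinSeq) → Σ BinSeq (λ b → SomeOne a ↔ AllZero b)

WPFP : Set
WPFP = ∀ (a : BinSeq) → Σ BinSeq (λ b → AllZero a ↔ ¬ AllZero b)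

co-WPFP : Set
co-WPFP = ∀ (a : BinSeq) → Σ BinSeq (λ b → ¬ AllZero a ↔ AllZero b)

module Submission where

-- The one fact about binary sequences used throughout is that "a is
-- identically 0" is ¬¬-stable, because each "a n = 0" is decidable.
--
-- (1) LPO ⇒ co-PFP is immediate: b is the constant 1 or the constant 0
-- sequence, according to the LPO decision for a.  For co-PFP ⇒ LPO we
-- first derive Markov's principle from co-PFP (the witness b for a is all
-- 0 by stability, since otherwise a would have no 1).  Given a and its
-- co-PFP witness b, the sequence c = a ∨ b cannot be all 0, so MP finds
-- an index where a or b is 1; in the first case a has a 1, in the second
-- b is not all 0 and hence a is all 0.
--
-- (2) For propositions P, Q with Q ¬¬-stable, P ↔ ¬Q implies ¬P ↔ Q.
-- With P, Q := "a is all 0", "b is all 0" this turns a WPFP witness into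
-- a co-WPFP witness, and (applied with the roles swapped) vice versa.

open import Defs
open import Data.Bool using (Bool; true; false; _∨_; _≟_)
open import Data.Bool.Properties using (¬-not; ∨-conicalˡ; ∨-conicalʳ)
open import Data.Product using (_×_; _,_)
open import Data.Sum using (_⊎_; inj₁; inj₂)
open import Relation.Nullary using (¬_)
open import Relation.Nullary.Decidable using (decidable-stable)
open import Relation.Nullary.Negation using (Stable; ¬¬-map; contradiction)
open import Relation.Binary.PropositionalEquality using (_≡_; refl; sym; trans)

↔-sym : {P Q : Set} → (P ↔ Q) → (Q ↔ P)
↔-sym (f , g) = g , f

¬↔-transpose : {P Q : Set} → Stable Q → (P ↔ ¬ Q) → (¬ P ↔ Q)
¬↔-transpose stableQ (P⇒¬Q , ¬Q⇒P) =
  (λ ¬p → stableQ (λ ¬q → ¬p (¬Q⇒P ¬q))) , (λ q p → P⇒¬Q p q)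

allZero-stable : (a : BinSeq) → Stable (AllZero a)
allZero-stable a ¬¬zeroA n =
  decidable-stable (a n ≟ false) (¬¬-map (λ zeroA → zeroA n) ¬¬zeroA)

¬someOne⇒allZero : (a : BinSeq) → ¬ SomeOne a → AllZero a
¬someOne⇒allZero a noOne n = ¬-not (λ an≡1 → noOne (n , an≡1))

someOne⇒¬allZero : (a : BinSeq) → SomeOne a → ¬ AllZero a
someOne⇒¬allZero a (n , an≡1) zeroA with () ← trans (sym an≡1) (zeroA n)

MarkovPrinciple : Set
MarkovPrinciple = (a : BinSeq) → ¬ AllZero a → SomeOne a

-- co-PFP implies MP: the witness b for a is all 0, by stability, since
-- ¬ AllZero b would leave a without a 1.
co-PFP⇒MP : co-PFP → MarkovPrinciple
co-PFP⇒MP coPFP a ¬zeroA with coPFP a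
... | b , (oneA⇒zeroB , zeroB⇒oneA) =
  zeroB⇒oneA (allZero-stable b λ ¬zeroB →
    ¬zeroA (¬someOne⇒allZero a λ oneA → ¬zeroB (oneA⇒zeroB oneA)))

∨-true : (x y : Bool) → x ∨ y ≡ true → (x ≡ true) ⊎ (y ≡ true)
∨-true true  _ _   = inj₁ refl
∨-true false _ y≡1 = inj₂ y≡1

-- For a co-PFP witness b of a, the pointwise disjunction a ∨ b is not all
-- 0: otherwise b would be all 0, so a would have a 1, yet a is all 0.
disjunction-¬allZero : (a b : BinSeq) → (SomeOne a ↔ AllZero b) →
                       ¬ AllZero (λ n → a n ∨ b n)
disjunction-¬allZero a b (_ , zeroB⇒oneA) zeroA∨B =
  someOne⇒¬allZero a (zeroB⇒oneA zeroB) zeroA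
  where
  zeroA : AllZero a
  zeroA n = ∨-conicalˡ (a n) (b n) (zeroA∨B n)
  zeroB : AllZero b
  zeroB n = ∨-conicalʳ (a n) (b n) (zeroA∨B n)

-- Under MP, a co-PFP witness b for a decides a: MP finds a 1 in a ∨ b,
-- which lies either in a, or in b (and then a has no 1).
MP-decide : MarkovPrinciple → (a b : BinSeq) → (SomeOne a ↔ AllZero b) →
            AllZero a ⊎ SomeOne a
MP-decide mp a b witness@(oneA⇒zeroB , _)
  with mp (λ n → a n ∨ b n) (disjunction-¬allZero a b witness)
... | n , an∨bn≡1 with ∨-true (a n) (b n) an∨bn≡1
...   | inj₁ an≡1 = inj₂ (n , an≡1)
...   | inj₂ bn≡1 = inj₁ (¬someOne⇒allZero a λ oneA →
                        someOne⇒¬allZero b (n , bn≡1) (oneA⇒zeroB oneA))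

co-PFP⇒LPO : co-PFP → LPO
co-PFP⇒LPO coPFP a with coPFP a
... | b , witness = MP-decide (co-PFP⇒MP coPFP) a b witness

-- Under LPO the witness is constant: all 1 if a is all 0, all 0 otherwise.
LPO⇒co-PFP : LPO → co-PFP
LPO⇒co-PFP lpo a with lpo a
... | inj₁ zeroA = (λ _ → true) ,
      ((λ oneA → contradiction zeroA (someOne⇒¬allZero a oneA)) ,
       (λ zeroOnes → contradiction (zeroOnes 0) λ ()))
... | inj₂ oneA = (λ _ → false) , ((λ _ _ → refl) , (λ _ → oneA))

WPFP⇒co-WPFP : WPFP → co-WPFP
WPFP⇒co-WPFP wpfp a with wpfp a
... | b , witness = b , ¬↔-transpose (allZero-stable b) witness

co-WPFP⇒WPFP : co-WPFP → WPFP
co-WPFP⇒WPFP coWPFP a with coWPFP a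
... | b , witness = b , ↔-sym (¬↔-transpose (allZero-stable a) (↔-sym witness))

proposition6p2p5 : (co-PFP ↔ LPO) × (co-WPFP ↔ WPFP)
proposition6p2p5 = (co-PFP⇒LPO , LPO⇒co-PFP) , (co-WPFP⇒WPFP , WPFP⇒co-WPFP)
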